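{- For every (possibly partial) class $\mathcal H$, $$\lfloor\log\mathtt{VC}(\mathcal H)\rfloor\le\lfloor\log\mathtt{VC}^{\mathrm a}(\mathcal H)\rfloor\le\mathtt{VC}^*(\mathcal H)\le\mathtt{VC}^{*\mathrm a}(\mathcal H)\le2^{\mathtt{VC}(\mathcal H)+1}-1,$$ and $$\mathtt{VC}^*(\mathcal H)\le\mathtt{VC}^{*\mathrm a}(\mathcal H)\le2\mathtt{VC}^*(\mathcal H)+1.$$ Moreover, each inequality between neighboring values above is sharp: for each there exist classes attaining equality.
   Context: A partial class over a domain $X$ is a set $\mathcal H\subseteq\{ -,+,*\}^X$ ($*$ meaning undefined, with $-*=*$); a (total) class is the case with no $*$ values. $S\subseteq X$ is shattered if for every $s:S\to\{ -,+\}$ some $h\in\mathcal H$ has $h|_S=s$, and antipodally shattered if for every such $s$ some $h$ has $h|_S=s$ or $h|_S=-s$. $\mathtt{VC}$ and $\mathtt{VC}^{\mathrm a}$ are the maximal sizes of shattered, resp. antipodally shattered, sets. $H\subseteq\mathcal H$ is dually shattered if for every $r:H\to\{ -,+\}$ there is $x\in X$ with $h(x)=r(h)$ for all $h\in H$, and dually antipodally shattered if for every $r$ there is $x$ with $h(x)=r(h)$ for all $h\in H$ or $h(x)=-r(h)$ for all $h\in H$. $\mathtt{VC}^*$ and $\mathtt{VC}^{*\mathrm a}$ are the maximal sizes of dually shattered, resp. dually antipodally shattered, sets. $\log$ is base $2$. -}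

module Defs where

open import Data.Nat using (ℕ; suc; _+_; _*_; _^_; _∸_)
open import Data.Fin using (Fin)
open import Data.Product using (Σ; ∃; _×_; _,_)
open import Data.Sum using (_⊎_)
open import Relation.Binary.PropositionalEquality using (_≡_)
open import Relation.Nullary using (¬_)
open import Function.Definitions using (Injective)

data Val : Set where
  neg pos undef : Val

data Sign : Set where
  minus plus : Sign

⌜_⌝ : Sign → Val
⌜ minus ⌝ = neg
⌜ plus ⌝ = pos

flipS : Sign → Sign
flipS minus = plus
flipS plus = minus

negV : Val → Val
negV neg = pos
negV pos = neg
negV undef = undef

Class : Set → Set₁
Class X = (X → Val) → Set

Shattered : {X : Set} → Class X → {n : ℕ} → (Fin n → X) → Set
Shattered {X} ℋ {n} S =
  (s : Fin n → Sign) → Σ (X → Val) λ h → ℋ h × (∀ i → h (S i) ≡ ⌜ s i ⌝)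

AShattered : {X : Set} → Class X → {n : ℕ} → (Fin n → X) → Set
AShattered {X} ℋ {n} S =
  (s : Fin n → Sign) → Σ (X → Val) λ h → ℋ h ×
    ((∀ i → h (S i) ≡ ⌜ s i ⌝) ⊎ (∀ i → h (S i) ≡ negV ⌜ s i ⌝))

DShattered : {X : Set} → Class X → {n : ℕ} → (Fin n → (X → Val)) → Set
DShattered {X} ℋ {n} H =
  (∀ i → ℋ (H i)) ×
  ((r : Fin n → Sign) → Σ X λ x → ∀ i → H i x ≡ ⌜ r i ⌝)

DAShattered : {X : Set} → Class X → {n : ℕ} → (Fin n → (X → Val)) → Set
DAShattered {X} ℋ {n} H =
  (∀ i → ℋ (H i)) ×
  ((r : Fin n → Sign) → Σ X λ x →
     (∀ i → H i x ≡ ⌜ r i ⌝) ⊎ (∀ i → H i x ≡ negV ⌜ r i ⌝))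

-- A dimension (maximal size, possibly infinite, possibly -∞ if no set
-- qualifies) is represented by the predicate "dimension ≥ n", i.e.
-- "there is a qualifying set of exactly n distinct elements".
Dim : Set₁
Dim = ℕ → Set

VC : {X : Set} → Class X → Dim
VC {X} ℋ n = Σ (Fin n → X) λ S → Injective _≡_ _≡_ S × Shattered ℋ S

VCᵃ : {X : Set} → Class X → Dim
VCᵃ {X} ℋ n = Σ (Fin n → X) λ S → Injective _≡_ _≡_ S × AShattered ℋ S

VC* : {X : Set} → Class X → Dim
VC* {X} ℋ n = Σ (Fin n → (X → Val)) λ H → Injective _≡_ _≡_ H × DShattered ℋ H

VC*ᵃ : {X : Set} → Class X → Dim
VC*ᵃ {X} ℋ n = Σ (Fin n → (X → Val)) λ H → Injective _≡_ _≡_ H × DAShattered ℋ H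

-- Comparisons between dimensions (valid also for infinite values):
-- a ≤ b
_≤ᵈ_ : Dim → Dim → Set
a ≤ᵈ b = ∀ n → a n → b n

-- ⌊log a⌋ ≤ ⌊log b⌋
LogLeLog : Dim → Dim → Set
LogLeLog a b = ∀ k → a (2 ^ k) → b (2 ^ k)

-- ⌊log a⌋ ≤ b
LogLe : Dim → Dim → Set
LogLe a b = ∀ k → a (2 ^ k) → b k

-- a ≤ 2^(b+1) - 1
LeExp : Dim → Dim → Set
LeExp a b = ∀ m → a (2 ^ m) → b m

-- a ≤ 2 b + 1
LeTwiceSuc : Dim → Dim → Set
LeTwiceSuc a b = ∀ n → a (2 * n + 2) → b (suc n)

-- a = m (exactly, m finite)
_≐_ : Dim → ℕ → Set
a ≐ m = a m × ¬ a (suc m)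

-- ⌊log a⌋ = d (exactly)
LogEq : Dim → ℕ → Set
LogEq a d = a (2 ^ d) × ¬ a (2 ^ suc d)

∃Class : ({X : Set} → Class X → Set) → Set₁
∃Class P = Σ Set λ X → Σ (Class X) λ ℋ → P ℋ

{-# OPTIONS --safe #-}
module Submission where

-- Index the points of an antipodally shattered set of size 2 ^ k by the sign vectors of
-- length k.  The k concepts realising the k coordinate patterns (each up to a global sign)
-- are then dually shattered: to realise r, take the point indexed by r after flipping the
-- coordinates whose concept realised its pattern negated.  Exchanging points and concepts
-- gives ⌊log VC*ᵃ⌋ ≤ VC.  For VC*ᵃ ≤ 2 VC* + 1, cut a dually antipodally shattered
-- family of size 2m into halves L and R: either every sign pattern on L extends to a
-- pattern on L ∪ R realised exactly, and L is dually shattered, or some pattern on L extends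
-- only to patterns realised negated, and then R is dually shattered.
-- The extremal classes are all concepts on 2 ^ d points, the N coordinate functions on the
-- sign vectors of length N, and the 2d+1 coordinate functions on the sign vectors of length
-- 2d+1 with at most d minus signs: of r and its negation exactly one lies there, while no
-- d+1 coordinates are ever minus at once.

open import Defs
open import Data.Nat using (ℕ; zero; suc; _+_; _*_; _^_; _∸_; _≤_; _<_; _≤?_)
open import Data.Nat.Properties
  using (≤-trans; ≰⇒>; <⇒≱; <⇒≤pred; +-suc; +-monoˡ-≤; +-cancelˡ-≤; 1+n≰n; n<1+n; m≤m+n;
         m^n>0; ^-monoʳ-<; ∸-monoʳ-<; pred[m∸n]≡m∸[1+n]; m≤n⇒∃[o]m+o≡n)
open import Data.Nat.Tactic.RingSolver using (solve-∀)
open import Data.Fin using (Fin; zero; suc; _↑ˡ_; _↑ʳ_; finToFun; funToFin; combine)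
open import Data.Fin.Properties
  using (finToFun-funToFin; funToFin-finToFin; suc-injective; injective⇒≤; all?; any?; ¬∀⟶∃¬)
open import Data.Product using (Σ; ∃; _×_; _,_; proj₁; proj₂)
open import Data.Sum using (_⊎_; inj₁; inj₂)
import Data.Sum as Sum
open import Data.Unit using (tt)
open import Data.Vec.Functional using (_++_)
open import Data.Vec.Functional.Properties using (lookup-++ˡ; lookup-++ʳ)
open import Function using (_∘_; id)
open import Function.Definitions using (Injective)
open import Relation.Binary.PropositionalEquality
open import Relation.Nullary using (¬_; Dec; yes; no; contradiction)
open import Relation.Unary using (U)

⌜⌝-injective : ∀ {σ τ} → ⌜ σ ⌝ ≡ ⌜ τ ⌝ → σ ≡ τ
⌜⌝-injective {minus} {minus} _ = refl
⌜⌝-injective {plus}  {plus}  _ = refl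

negV-involutive : ∀ v → negV (negV v) ≡ v
negV-involutive neg   = refl
negV-involutive pos   = refl
negV-involutive undef = refl

negV-injective : ∀ {u v} → negV u ≡ negV v → u ≡ v
negV-injective {u} {v} e = trans (sym (negV-involutive u)) (trans (cong negV e) (negV-involutive v))

⌜flipS⌝ : ∀ σ → ⌜ flipS σ ⌝ ≡ negV ⌜ σ ⌝
⌜flipS⌝ minus = refl
⌜flipS⌝ plus  = refl

negV-⌜flipS⌝ : ∀ σ → negV ⌜ flipS σ ⌝ ≡ ⌜ σ ⌝
negV-⌜flipS⌝ σ = trans (cong negV (⌜flipS⌝ σ)) (negV-involutive ⌜ σ ⌝)

toSign : Fin 2 → Sign
toSign zero       = minus
toSign (suc zero) = plus

fromSign : Sign → Fin 2
fromSign minus = zero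
fromSign plus  = suc zero

toSign-fromSign : ∀ σ → toSign (fromSign σ) ≡ σ
toSign-fromSign minus = refl
toSign-fromSign plus  = refl

fromSign-toSign : ∀ b → fromSign (toSign b) ≡ b
fromSign-toSign zero       = refl
fromSign-toSign (suc zero) = refl

toSign-injective : ∀ {x y} → toSign x ≡ toSign y → x ≡ y
toSign-injective {x} {y} e =
  trans (sym (fromSign-toSign x)) (trans (cong fromSign e) (fromSign-toSign y))

funToFin-cong : ∀ {m n} {f g : Fin m → Fin n} → f ≗ g → funToFin f ≡ funToFin g
funToFin-cong {zero}  _   = refl
funToFin-cong {suc m} f≗g = cong₂ combine (f≗g zero) (funToFin-cong (f≗g ∘ suc))

toSigns : ∀ {k} → Fin (2 ^ k) → Fin k → Sign
toSigns {k} a = toSign ∘ finToFun {2} {k} a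

fromSigns : ∀ {k} → (Fin k → Sign) → Fin (2 ^ k)
fromSigns r = funToFin (fromSign ∘ r)

toSigns-fromSigns : ∀ {k} (r : Fin k → Sign) → toSigns (fromSigns r) ≗ r
toSigns-fromSigns r i =
  trans (cong toSign (finToFun-funToFin (fromSign ∘ r) i)) (toSign-fromSign (r i))

toSigns-injective : ∀ {k} {a b : Fin (2 ^ k)} → toSigns {k} a ≗ toSigns b → a ≡ b
toSigns-injective {k} {a} {b} eq = begin
  a                                 ≡⟨ funToFin-finToFin {k} {2} a ⟨
  funToFin (finToFun {2} {k} a)     ≡⟨ funToFin-cong (toSign-injective ∘ eq) ⟩
  funToFin (finToFun {2} {k} b)     ≡⟨ funToFin-finToFin {k} {2} b ⟩
  b                                 ∎
  where open ≡-Reasoning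

signs-separate : ∀ {n} {c c′ : Fin n} → (∀ (s : Fin n → Sign) → s c ≡ s c′) → c ≡ c′
signs-separate {c = zero}  {zero}   _ = refl
signs-separate {c = zero}  {suc _}  h = contradiction (h λ { zero → plus ; (suc _) → minus }) λ ()
signs-separate {c = suc _} {zero}   h = contradiction (h λ { zero → plus ; (suc _) → minus }) λ ()
signs-separate {c = suc c} {suc c′} h =
  cong suc (signs-separate λ s → h λ { zero → plus ; (suc i) → s i })

module _ {C : Set} where

  Realises : (C → Val) → (C → Sign) → Set
  Realises v s = ∀ c → v c ≡ ⌜ s c ⌝

  Realisesᵃ : (C → Val) → (C → Sign) → Set
  Realisesᵃ v s = Realises v s ⊎ (∀ c → v c ≡ negV ⌜ s c ⌝)

  orient : ∀ {v s} → Realisesᵃ v s → Sign → Sign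
  orient (inj₁ _) σ = σ
  orient (inj₂ _) σ = flipS σ

  realisesᵃ-orient : ∀ {v s c σ} (o : Realisesᵃ v s) → s c ≡ orient o σ → v c ≡ ⌜ σ ⌝
  realisesᵃ-orient {c = c}     (inj₁ p) e = trans (p c) (cong ⌜_⌝ e)
  realisesᵃ-orient {c = c} {σ} (inj₂ p) e =
    trans (p c) (trans (cong (negV ∘ ⌜_⌝) e) (negV-⌜flipS⌝ σ))

  realisesᵃ-≡ : ∀ {v s c c′} → Realisesᵃ v s → v c ≡ v c′ → s c ≡ s c′
  realisesᵃ-≡ {c = c} {c′} (inj₁ p) e = ⌜⌝-injective (trans (sym (p c)) (trans e (p c′)))
  realisesᵃ-≡ {c = c} {c′} (inj₂ p) e =
    ⌜⌝-injective (negV-injective (trans (sym (p c)) (trans e (p c′))))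

-- Shattered ℋ S amounts to Shatters (onPoints ℋ S), whose rows are the members of ℋ, and
-- DShattered ℋ H to Shatters (flip H), whose rows are the points; so each argument about
-- these matrices serves for points and concepts alike.
module _ {A C : Set} where

  Shatters : (A → C → Val) → Set
  Shatters M = ∀ s → Σ A λ a → Realises (M a) s

  Shattersᵃ : (A → C → Val) → Set
  Shattersᵃ M = ∀ s → Σ A λ a → Realisesᵃ (M a) s

  shatters⇒shattersᵃ : ∀ {M} → Shatters M → Shattersᵃ M
  shatters⇒shattersᵃ sh s = let a , p = sh s in a , inj₁ p

IsInj₁ : ∀ {A B : Set} → A ⊎ B → Set
IsInj₁ u = ∃ λ a → u ≡ inj₁ a

isInj₁? : ∀ {A B : Set} (u : A ⊎ B) → Dec (IsInj₁ u)
isInj₁? (inj₁ a) = yes (a , refl)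
isInj₁? (inj₂ _) = no λ { (_ , ()) }

fromInj₂ : ∀ {A B : Set} (u : A ⊎ B) → ¬ IsInj₁ u → B
fromInj₂ (inj₁ a) ¬l = contradiction (a , refl) ¬l
fromInj₂ (inj₂ b) _  = b

module _ {A : Set} where

  shattersᵃ⇒distinct-columns : ∀ {n} {M : A → Fin n → Val} → Shattersᵃ M →
                               ∀ {c c′} → (∀ a → M a c ≡ M a c′) → c ≡ c′
  shattersᵃ⇒distinct-columns sh eq =
    signs-separate λ s → let a , o = sh s in realisesᵃ-≡ o (eq a)

  shatters⇒2^k-distinct-rows : ∀ {k} {M : A → Fin k → Val} → Shatters M →
                               Σ (Fin (2 ^ k) → A) λ w → ∀ {a b} → M (w a) ≗ M (w b) → a ≡ b
  shatters⇒2^k-distinct-rows {k} sh =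
    proj₁ ∘ sh ∘ toSigns , λ {a} {b} eq → toSigns-injective {k} λ i →
      ⌜⌝-injective (trans (sym (proj₂ (sh (toSigns a)) i)) (trans (eq i) (proj₂ (sh (toSigns b)) i)))

  shattersᵃ⇒transpose-shatters : ∀ {k} {M : A → Fin (2 ^ k) → Val} → Shattersᵃ M →
                                 Σ (Fin k → A) λ w → Shatters (λ c i → M (w i) c)
  shattersᵃ⇒transpose-shatters {k} {M} sh = w , λ r → let c = fromSigns (flipped r) in
    c , λ i → realisesᵃ-orient (orientation i) (toSigns-fromSigns (flipped r) i)
    where
    coordinate : Fin k → Fin (2 ^ k) → Sign
    coordinate i c = toSigns {k} c i
    w : Fin k → A
    w i = proj₁ (sh (coordinate i))
    orientation : ∀ i → Realisesᵃ (M (w i)) (coordinate i)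
    orientation i = proj₂ (sh (coordinate i))
    flipped : (Fin k → Sign) → Fin k → Sign
    flipped r i = orient (orientation i) (r i)

  shattersᵃ-↑ˡ : ∀ {m n} {M : A → Fin (m + n) → Val} → Shattersᵃ M →
                 Shattersᵃ (λ a i → M a (i ↑ˡ n))
  shattersᵃ-↑ˡ {n = n} sh s =
    let a , o = sh (s ++ λ _ → plus) in
    a , Sum.map (λ p i → trans (p (i ↑ˡ n)) (cong ⌜_⌝ (lookup-++ˡ s _ i)))
                (λ p i → trans (p (i ↑ˡ n)) (cong (negV ∘ ⌜_⌝) (lookup-++ˡ s _ i))) o

  module _ {m} {M : A → Fin (m + m) → Val} (sh : Shattersᵃ M) where

    private
      joint : Fin (2 ^ m) → Fin (2 ^ m) → Fin (m + m) → Sign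
      joint s t = toSigns {m} s ++ toSigns {m} t

      row : Fin (2 ^ m) → Fin (2 ^ m) → A
      row s t = proj₁ (sh (joint s t))

      Exact : Fin (2 ^ m) → Fin (2 ^ m) → Set
      Exact s t = IsInj₁ (proj₂ (sh (joint s t)))

      exact? : ∀ s t → Dec (Exact s t)
      exact? s t = isInj₁? (proj₂ (sh (joint s t)))

      left-shatters : (∀ s → ∃ (Exact s)) → Shatters (λ a i → M a (i ↑ˡ m))
      left-shatters ∀∃ r =
        let s = fromSigns r ; t , p , _ = ∀∃ s in
        row s t , λ i → trans (p (i ↑ˡ m))
          (cong ⌜_⌝ (trans (lookup-++ˡ (toSigns {m} s) (toSigns {m} t) i) (toSigns-fromSigns r i)))

      right-shatters : ∀ s → ¬ ∃ (Exact s) → Shatters (λ a i → M a (m ↑ʳ i))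
      right-shatters s ¬∃ r =
        let t = fromSigns (flipS ∘ r) ; p = fromInj₂ _ (¬∃ ∘ (t ,_)) in
        row s t , λ i → begin
          M (row s t) (m ↑ʳ i)          ≡⟨ p (m ↑ʳ i) ⟩
          negV ⌜ joint s t (m ↑ʳ i) ⌝
            ≡⟨ cong (negV ∘ ⌜_⌝) (lookup-++ʳ (toSigns {m} s) (toSigns {m} t) i) ⟩
          negV ⌜ toSigns {m} t i ⌝      ≡⟨ cong (negV ∘ ⌜_⌝) (toSigns-fromSigns (flipS ∘ r) i) ⟩
          negV ⌜ flipS (r i) ⌝          ≡⟨ negV-⌜flipS⌝ (r i) ⟩
          ⌜ r i ⌝                       ∎
        where open ≡-Reasoning

    shattersᵃ⇒half-shatters : Shatters (λ a i → M a (i ↑ˡ m)) ⊎ Shatters (λ a i → M a (m ↑ʳ i))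
    shattersᵃ⇒half-shatters with all? (λ s → any? (exact? s))
    ... | yes ∀∃ = inj₁ (left-shatters ∀∃)
    ... | no ¬∀∃ = let s , ¬∃ = ¬∀⟶∃¬ _ _ (λ s → any? (exact? s)) ¬∀∃ in inj₂ (right-shatters s ¬∃)

module _ {X : Set} (ℋ : Class X) where

  onPoints : ∀ {n} → (Fin n → X) → Σ (X → Val) ℋ → Fin n → Val
  onPoints S (h , _) i = h (S i)

  shattered⇒shatters : ∀ {n} {S : Fin n → X} → Shattered ℋ S → Shatters (onPoints S)
  shattered⇒shatters sh s = let h , h∈ℋ , p = sh s in (h , h∈ℋ) , p

  aShattered⇒shattersᵃ : ∀ {n} {S : Fin n → X} → AShattered ℋ S → Shattersᵃ (onPoints S)
  aShattered⇒shattersᵃ sh s = let h , h∈ℋ , p = sh s in (h , h∈ℋ) , p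

  VC-intro : ∀ {n} (S : Fin n → X) → Shattered ℋ S → VC ℋ n
  VC-intro S sh = S , S-injective , sh
    where
    S-injective : ∀ {i j} → S i ≡ S j → i ≡ j
    S-injective e = shattersᵃ⇒distinct-columns (shatters⇒shattersᵃ (shattered⇒shatters sh))
                                                 λ (h , _) → cong h e

  VC*ᵃ-intro : ∀ {n} (H : Fin n → X → Val) → DAShattered ℋ H → VC*ᵃ ℋ n
  VC*ᵃ-intro H dsh@(_ , sh) = H , (λ e → shattersᵃ⇒distinct-columns sh (cong-app e)) , dsh

  VC*-intro : ∀ {n} (H : Fin n → X → Val) → DShattered ℋ H → VC* ℋ n
  VC*-intro H dsh@(_ , sh) =
    H , (λ e → shattersᵃ⇒distinct-columns (shatters⇒shattersᵃ sh) (cong-app e)) , dsh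

  VC≤VCᵃ : VC ℋ ≤ᵈ VCᵃ ℋ
  VC≤VCᵃ _ (S , S-injective , sh) =
    S , S-injective , λ s → let h , h∈ℋ , p = sh s in h , h∈ℋ , inj₁ p

  VC*≤VC*ᵃ : VC* ℋ ≤ᵈ VC*ᵃ ℋ
  VC*≤VC*ᵃ _ (H , H-injective , H⊆ℋ , sh) = H , H-injective , H⊆ℋ , shatters⇒shattersᵃ sh

  log-VCᵃ≤VC* : LogLe (VCᵃ ℋ) (VC* ℋ)
  log-VCᵃ≤VC* k (S , _ , ash) =
    let w , sh = shattersᵃ⇒transpose-shatters (aShattered⇒shattersᵃ ash) in
    VC*-intro (proj₁ ∘ w) (proj₂ ∘ w , λ r → let c , p = sh r in S c , p)

  log-VC*ᵃ≤VC : LeExp (VC*ᵃ ℋ) (VC ℋ)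
  log-VC*ᵃ≤VC m (H , _ , H⊆ℋ , sh) =
    let w , sh′ = shattersᵃ⇒transpose-shatters sh in
    VC-intro w λ s → let c , p = sh′ s in H c , H⊆ℋ c , p

  VC*ᵃ-mono : ∀ {m n} → m ≤ n → VC*ᵃ ℋ n → VC*ᵃ ℋ m
  VC*ᵃ-mono m≤n v with m≤n⇒∃[o]m+o≡n m≤n
  ... | o , refl = let H , _ , H⊆ℋ , sh = v in
                   VC*ᵃ-intro (H ∘ (_↑ˡ o)) (H⊆ℋ ∘ (_↑ˡ o) , shattersᵃ-↑ˡ sh)

  VC*ᵃ[m+m]⇒VC*[m] : ∀ m → VC*ᵃ ℋ (m + m) → VC* ℋ m
  VC*ᵃ[m+m]⇒VC*[m] m (H , _ , H⊆ℋ , sh) with shattersᵃ⇒half-shatters {m = m} sh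
  ... | inj₁ left  = VC*-intro (H ∘ (_↑ˡ m)) (H⊆ℋ ∘ (_↑ˡ m) , left)
  ... | inj₂ right = VC*-intro (H ∘ (m ↑ʳ_)) (H⊆ℋ ∘ (m ↑ʳ_) , right)

  VC*ᵃ≤2VC*+1 : LeTwiceSuc (VC*ᵃ ℋ) (VC* ℋ)
  VC*ᵃ≤2VC*+1 n = VC*ᵃ[m+m]⇒VC*[m] (suc n) ∘ subst (VC*ᵃ ℋ) (2n+2≡[1+n]+[1+n] n)
    where
    2n+2≡[1+n]+[1+n] : ∀ n → 2 * n + 2 ≡ suc n + suc n
    2n+2≡[1+n]+[1+n] = solve-∀

FinClass : ∀ {X : Set} {N} → (Fin N → X → Val) → Class X
FinClass G h = ∃ λ j → h ≡ G j

module _ {X : Set} {N} (G : Fin N → X → Val) where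

  FinClass-index-injective : ∀ {k} {H : Fin k → X → Val} → Injective _≡_ _≡_ H →
                             (H⊆G : ∀ a → FinClass G (H a)) → Injective _≡_ _≡_ (proj₁ ∘ H⊆G)
  FinClass-index-injective H-injective H⊆G {a} {b} e =
    H-injective (trans (proj₂ (H⊆G a)) (trans (cong G e) (sym (proj₂ (H⊆G b)))))

  VC-FinClass⇒2^k≤N : ∀ {k} → VC (FinClass G) k → 2 ^ k ≤ N
  VC-FinClass⇒2^k≤N (S , _ , sh) =
    let w , w-injective = shatters⇒2^k-distinct-rows (shattered⇒shatters (FinClass G) sh) in
    injective⇒≤ {f = proj₁ ∘ proj₂ ∘ w} λ {a} {b} e → w-injective λ i →
      cong-app (trans (proj₂ (proj₂ (w a))) (trans (cong G e) (sym (proj₂ (proj₂ (w b)))))) (S i)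

  VC*ᵃ-FinClass⇒k≤N : ∀ {k} → VC*ᵃ (FinClass G) k → k ≤ N
  VC*ᵃ-FinClass⇒k≤N (_ , H-injective , H⊆G , _) =
    injective⇒≤ (FinClass-index-injective H-injective H⊆G)

  ¬VC*ᵃ-FinClass : ¬ VC*ᵃ (FinClass G) (suc N)
  ¬VC*ᵃ-FinClass = 1+n≰n ∘ VC*ᵃ-FinClass⇒k≤N

VC*-Fin⇒2^k≤N : ∀ {N k} (ℋ : Class (Fin N)) → VC* ℋ k → 2 ^ k ≤ N
VC*-Fin⇒2^k≤N _ (H , _ , _ , sh) =
  let w , w-injective = shatters⇒2^k-distinct-rows sh in
  injective⇒≤ {f = w} λ e → w-injective λ i → cong (H i) e

2^d<2^[1+d] : ∀ d → 2 ^ d < 2 ^ suc d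
2^d<2^[1+d] d = ^-monoʳ-< 2 (n<1+n 1) (n<1+n d)

VC-U : ∀ {N} → VC {Fin N} U N
VC-U = VC-intro U id λ s → ⌜_⌝ ∘ s , tt , λ _ → refl

VC*-U : ∀ {k} → VC* {Fin (2 ^ k)} U k
VC*-U {k} = VC*-intro U (λ i a → ⌜ toSigns {k} a i ⌝)
  ((λ _ → tt) , λ r → fromSigns r , λ i → cong ⌜_⌝ (toSigns-fromSigns r i))

¬VC*-U : ∀ d → ¬ VC* {Fin (2 ^ d)} U (suc d)
¬VC*-U d = <⇒≱ (2^d<2^[1+d] d) ∘ VC*-Fin⇒2^k≤N U

VC*-U≐ : ∀ d → VC* {Fin (2 ^ d)} U ≐ d
VC*-U≐ d = VC*-U , ¬VC*-U d

logVCᵃ-U≐ : ∀ d → LogEq (VCᵃ {Fin (2 ^ d)} U) d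
logVCᵃ-U≐ d = VC≤VCᵃ U _ VC-U , ¬VC*-U d ∘ log-VCᵃ≤VC* U (suc d)

logVC-U≐ : ∀ d → LogEq (VC {Fin (2 ^ d)} U) d
logVC-U≐ d = VC-U , proj₂ (logVCᵃ-U≐ d) ∘ VC≤VCᵃ U _

coordinate : ∀ {X : Set} {N} → (X → Fin N → Sign) → Fin N → X → Val
coordinate point j x = ⌜ point x j ⌝

Coordinates : ∀ {X : Set} {N} → (X → Fin N → Sign) → Class X
Coordinates point = FinClass (coordinate point)

VC*-Coordinates : ∀ {N} → VC* (Coordinates {Fin N → Sign} id) N
VC*-Coordinates =
  VC*-intro (Coordinates id) (coordinate id) ((λ j → j , refl) , λ r → r , λ _ → refl)

VC*ᵃ-Coordinates≐ : ∀ {N} → VC*ᵃ (Coordinates {Fin N → Sign} id) ≐ N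
VC*ᵃ-Coordinates≐ = VC*≤VC*ᵃ (Coordinates id) _ VC*-Coordinates , ¬VC*ᵃ-FinClass (coordinate id)

VC*-Coordinates≐ : ∀ {N} → VC* (Coordinates {Fin N → Sign} id) ≐ N
VC*-Coordinates≐ = VC*-Coordinates , ¬VC*ᵃ-FinClass (coordinate id) ∘ VC*≤VC*ᵃ (Coordinates id) _

VC-Coordinates≐ : ∀ {N d} → 2 ^ d ≤ N → N < 2 ^ suc d → VC (Coordinates {Fin N → Sign} id) ≐ d
VC-Coordinates≐ {d = d} 2^d≤N N<2^[1+d] =
  log-VC*ᵃ≤VC (Coordinates id) d (VC*ᵃ-mono (Coordinates id) 2^d≤N (proj₁ VC*ᵃ-Coordinates≐)) ,
  <⇒≱ N<2^[1+d] ∘ VC-FinClass⇒2^k≤N (coordinate id)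

#minus : ∀ {n} → (Fin n → Sign) → ℕ
#minus {zero}  x = 0
#minus {suc n} x with x zero
... | minus = suc (#minus (x ∘ suc))
... | plus  = #minus (x ∘ suc)

#minus-flipS : ∀ {n} (x : Fin n → Sign) → #minus x + #minus (flipS ∘ x) ≡ n
#minus-flipS {zero}  x = refl
#minus-flipS {suc n} x with x zero
... | minus = cong suc (#minus-flipS (x ∘ suc))
... | plus  = trans (+-suc _ _) (cong suc (#minus-flipS (x ∘ suc)))

rank : ∀ {n} (x : Fin n → Sign) (j : Fin n) → x j ≡ minus → Fin (#minus x)
rank {suc n} x zero    p with x zero
... | minus = zero
rank {suc n} x (suc j) p with x zero
... | minus = suc (rank (x ∘ suc) j p)
... | plus  = rank (x ∘ suc) j p

rank-injective : ∀ {n} (x : Fin n → Sign) {j j′ p p′} → rank x j p ≡ rank x j′ p′ → j ≡ j′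
rank-injective {suc n} x {zero}  {zero}            _  = refl
rank-injective {suc n} x {zero}  {suc j′} eq with x zero
... | minus = contradiction eq λ ()
rank-injective {suc n} x {suc j} {zero}  eq with x zero
... | minus = contradiction eq λ ()
rank-injective {suc n} x {suc j} {suc j′}          eq with x zero
... | minus = cong suc (rank-injective (x ∘ suc) (suc-injective eq))
... | plus  = cong suc (rank-injective (x ∘ suc) eq)

#minus-≥ : ∀ {k n} (x : Fin n → Sign) {j : Fin k → Fin n} → Injective _≡_ _≡_ j →
           (∀ a → x (j a) ≡ minus) → k ≤ #minus x
#minus-≥ x {j} j-injective j-minus =
  injective⇒≤ {f = λ a → rank x (j a) (j-minus a)} (j-injective ∘ rank-injective x)

Minority : ℕ → Set
Minority d = Σ (Fin (2 * d + 1) → Sign) λ x → #minus x ≤ d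

module _ (d : ℕ) where

  majority⇒flipS-minority : ∀ (r : Fin (2 * d + 1) → Sign) → ¬ #minus r ≤ d → #minus (flipS ∘ r) ≤ d
  majority⇒flipS-minority r r-majority = +-cancelˡ-≤ (suc d) _ _ (begin
    suc d + #minus (flipS ∘ r)      ≤⟨ +-monoˡ-≤ _ (≰⇒> r-majority) ⟩
    #minus r + #minus (flipS ∘ r)   ≡⟨ #minus-flipS r ⟩
    2 * d + 1                       ≡⟨ 2d+1≡[1+d]+d d ⟩
    suc d + d                       ∎)
    where
    open Data.Nat.Properties.≤-Reasoning
    2d+1≡[1+d]+d : ∀ d → 2 * d + 1 ≡ suc d + d
    2d+1≡[1+d]+d = solve-∀

  VC*ᵃ-Minority : VC*ᵃ (Coordinates {Minority d} proj₁) (2 * d + 1)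
  VC*ᵃ-Minority = VC*ᵃ-intro (Coordinates proj₁) (coordinate proj₁) ((λ j → j , refl) , realise)
    where
    realise : ∀ r → Σ (Minority d) λ x → Realisesᵃ (λ j → coordinate proj₁ j x) r
    realise r with #minus r ≤? d
    ... | yes r-minority = (r , r-minority) , inj₁ λ _ → refl
    ... | no  r-majority = (flipS ∘ r , majority⇒flipS-minority r r-majority) , inj₂ (⌜flipS⌝ ∘ r)

  ¬VC*-Minority : ¬ VC* (Coordinates {Minority d} proj₁) (suc d)
  ¬VC*-Minority (H , H-injective , H⊆G , sh) =
    let (x , x-minority) , H≡neg = sh (λ _ → minus) in
    1+n≰n (≤-trans (#minus-≥ x G-index-injective (minus-at-indices H≡neg)) x-minority)
    where
    G-index-injective : Injective _≡_ _≡_ (proj₁ ∘ H⊆G)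
    G-index-injective = FinClass-index-injective (coordinate proj₁) H-injective H⊆G
    minus-at-indices : ∀ {x} → (∀ a → H a x ≡ neg) → ∀ a → proj₁ x (proj₁ (H⊆G a)) ≡ minus
    minus-at-indices H≡neg a = ⌜⌝-injective (trans (sym (cong-app (proj₂ (H⊆G a)) _)) (H≡neg a))

VC*ᵃ-Minority≐ : ∀ d → VC*ᵃ (Coordinates {Minority d} proj₁) ≐ (2 * d + 1)
VC*ᵃ-Minority≐ d = VC*ᵃ-Minority d , ¬VC*ᵃ-FinClass (coordinate proj₁)

VC*-Minority≐ : ∀ d → VC* (Coordinates {Minority d} proj₁) ≐ d
VC*-Minority≐ d =
  VC*ᵃ[m+m]⇒VC*[m] ℋ d (VC*ᵃ-mono ℋ d+d≤2d+1 (VC*ᵃ-Minority d)) , ¬VC*-Minority d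
  where
  ℋ : Class (Minority d)
  ℋ = Coordinates proj₁
  d+d+1≡2d+1 : ∀ d → d + d + 1 ≡ 2 * d + 1
  d+d+1≡2d+1 = solve-∀
  d+d≤2d+1 : d + d ≤ 2 * d + 1
  d+d≤2d+1 = subst (d + d ≤_) (d+d+1≡2d+1 d) (m≤m+n (d + d) 1)

2^d≤2^[1+d]∸1 : ∀ d → 2 ^ d ≤ 2 ^ suc d ∸ 1
2^d≤2^[1+d]∸1 d = subst (2 ^ d ≤_) (pred[m∸n]≡m∸[1+n] (2 ^ suc d) 0) (<⇒≤pred (2^d<2^[1+d] d))

2^[1+d]∸1<2^[1+d] : ∀ d → 2 ^ suc d ∸ 1 < 2 ^ suc d
2^[1+d]∸1<2^[1+d] d = ∸-monoʳ-< (n<1+n 0) (m^n>0 2 (suc d))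

lemma2p1 :
    ((X : Set) (ℋ : Class X) →
        LogLeLog (VC ℋ) (VCᵃ ℋ)
      × LogLe (VCᵃ ℋ) (VC* ℋ)
      × (VC* ℋ ≤ᵈ VC*ᵃ ℋ)
      × LeExp (VC*ᵃ ℋ) (VC ℋ)
      × LeTwiceSuc (VC*ᵃ ℋ) (VC* ℋ))
    ×
    ((d : ℕ) →
        ∃Class (λ ℋ → LogEq (VC ℋ) d × LogEq (VCᵃ ℋ) d)
      × ∃Class (λ ℋ → LogEq (VCᵃ ℋ) d × (VC* ℋ ≐ d))
      × ∃Class (λ ℋ → (VC* ℋ ≐ d) × (VC*ᵃ ℋ ≐ d))
      × ∃Class (λ ℋ → (VC*ᵃ ℋ ≐ (2 ^ suc d ∸ 1)) × (VC ℋ ≐ d))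
      × ∃Class (λ ℋ → (VC*ᵃ ℋ ≐ (2 * d + 1)) × (VC* ℋ ≐ d)))
lemma2p1 =
  (λ X ℋ → (λ k → VC≤VCᵃ ℋ (2 ^ k)) , log-VCᵃ≤VC* ℋ , VC*≤VC*ᵃ ℋ , log-VC*ᵃ≤VC ℋ , VC*ᵃ≤2VC*+1 ℋ) ,
  λ d → (Fin (2 ^ d) , U , logVC-U≐ d , logVCᵃ-U≐ d)
      , (Fin (2 ^ d) , U , logVCᵃ-U≐ d , VC*-U≐ d)
      , (_ , Coordinates id , VC*-Coordinates≐ , VC*ᵃ-Coordinates≐)
      , (_ , Coordinates id , VC*ᵃ-Coordinates≐ ,
         VC-Coordinates≐ (2^d≤2^[1+d]∸1 d) (2^[1+d]∸1<2^[1+d] d))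
      , (Minority d , Coordinates proj₁ , VC*ᵃ-Minority≐ d , VC*-Minority≐ d)
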